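{- Let $n>1$ be an integer. Let $H_{2n,2n+2}$ be the graph on vertices $v_0,\dots,v_{2n+1}$ with $v_i\sim v_j$ iff $i\ne j$ and $j\not\equiv i+n+1\pmod{2n+2}$. Fix a non-adjacent pair $\{v_k,v_{k+n+1}\}$, let $S$ be the set of the remaining $2n$ vertices (so the induced subgraph on $S$ is isomorphic to $H_{2n-2,2n}$, i.e. $K_{2n}$ minus a perfect matching), and let $H^{\dagger}_{2n,2n+2}$ be the graph obtained by deleting all edges with both ends in $S$ and adding $2n-2$ new vertices, each adjacent to every vertex of $S$. Then $H^{\dagger}_{2n,2n+2}$ is distance magic.
   Context: A distance magic labeling of a graph $G$ on $N$ vertices is a bijection $f:V(G)\to\{1,\dots,N\}$ such that $w_G(u)=\sum_{v\in N_G(u)}f(v)$ is the same constant for all vertices $u$; $G$ is distance magic if it has one. -}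

module Defs where

open import Data.Nat using (ℕ; zero; suc; _+_; _*_; _<_; _≡ᵇ_; _<ᵇ_; _%_)
open import Data.Bool using (Bool; true; false; _∧_; _∨_; not; if_then_else_)
open import Data.Fin using (Fin; toℕ)
open import Data.List using (List; map)
open import Data.Nat.ListAction using (sum)
open import Data.List.Base using (allFin)
open import Data.Product using (Σ; ∃; _×_)
open import Function.Bundles using (_⤖_; Bijection)
open import Relation.Binary.PropositionalEquality using (_≡_)

Graph : ℕ → Set
Graph N = Fin N → Fin N → Bool

weight : {N : ℕ} → Graph N → (Fin N → ℕ) → Fin N → ℕ
weight {N} G f u = sum (map (λ v → if G u v then f v else 0) (allFin N))

-- f is a distance magic labelling: f is a bijection V → {1,…,N}, presented
-- as f v = 1 + σ v for a bijection σ : Fin N ⤖ Fin N, and all weights agree.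
IsDistanceMagicLabelling : {N : ℕ} → Graph N → (Fin N → ℕ) → Set
IsDistanceMagicLabelling {N} G f =
  (Σ (Fin N ⤖ Fin N) λ σ → ∀ v → f v ≡ suc (toℕ (Bijection.to σ v)))
  × (∃ λ c → ∀ u → weight G f u ≡ c)

IsDistanceMagic : {N : ℕ} → Graph N → Set
IsDistanceMagic G = ∃ λ f → IsDistanceMagicLabelling G f

Hadj : (n i j : ℕ) → Bool
Hadj n i j = not (i ≡ᵇ j) ∧ not (j ≡ᵇ ((i + n + 1) % suc (suc (2 * n))))

-- H†_{2n,2n+2} with respect to the non-adjacent pair {v_k, v_{k+n+1}}.
-- Vertex set Fin (4n): labels 0,…,2n+1 are v_0,…,v_{2n+1};
-- labels 2n+2,…,4n-1 are the 2n-2 new vertices.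
module HDagger (n k : ℕ) where
  a b : ℕ
  a = k
  b = (k + n + 1) % suc (suc (2 * n))
  orig : ℕ → Bool
  orig i = i <ᵇ suc (suc (2 * n))
  inS : ℕ → Bool
  inS i = orig i ∧ not (i ≡ᵇ a) ∧ not (i ≡ᵇ b)
  new : ℕ → Bool
  new i = not (orig i)
  adjℕ : ℕ → ℕ → Bool
  adjℕ i j = (orig i ∧ orig j ∧ Hadj n i j ∧ not (inS i ∧ inS j))
           ∨ (new i ∧ inS j) ∨ (inS i ∧ new j)

HDaggerGraph : (n k : ℕ) → Graph (4 * n)
HDaggerGraph n k u v = HDagger.adjℕ n k (toℕ u) (toℕ v)

-- H† is the complete bipartite graph K_{2n,2n} with parts S and its complement
-- {v_k, v_{k+n+1}} ∪ {new vertices}: among the original vertices the only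
-- non-edges join antipodes v_i, v_{i+n+1}, so v_k and v_{k+n+1} are adjacent to
-- all of S and not to each other.  In K_{m,m} a vertex's weight is the label sum
-- of the opposite part, so it suffices that both parts carry the same label sum.
-- Label v_i by i+1 for i ≤ n and give the remaining vertices (v_{n+1},…,v_{2n+1},
-- then the new ones) the labels 4n, 4n−1, …, n+2 in order.  Antipodal vertices,
-- and new vertices in mirror position, then have labels summing to 4n+1, so each
-- part carries n(4n+1).
module Submission where

open import Defs
open import Data.Bool using (Bool; true; false; _∧_; _∨_; _xor_; not; if_then_else_; T)
open import Data.Bool.Properties
  using (∨-∧-booleanAlgebra; ∨-identityʳ; not-involutive; ¬-not; T-∨; T-≡)
open import Algebra.Lattice.Properties.BooleanAlgebra ∨-∧-booleanAlgebra using (deMorgan₂)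
open import Data.Empty using (⊥; ⊥-elim)
open import Data.Fin as Fin using (Fin; toℕ; fromℕ<)
open import Data.Fin.Properties using (toℕ-fromℕ<; toℕ-injective; toℕ<n)
open import Data.List using (map; tabulate; allFin)
open import Data.List.Properties using (map-cong; map-tabulate)
open import Data.Nat
  using (ℕ; zero; suc; _+_; _*_; _∸_; _<_; _≤_; _≡ᵇ_; _%_; s≤s; z<s; s<s; s≤s⁻¹; s<s⁻¹)
open import Data.Nat.DivMod using (m<n⇒m%n≡m; [m+n]%n≡m%n; m%n<n)
open import Data.Nat.ListAction using (sum)
open import Data.Nat.Properties
open import Algebra.Properties.CommutativeSemigroup +-commutativeSemigroup
  using (interchange; x∙yz≈y∙xz)
open import Data.Nat.Tactic.RingSolver using (solve-∀)
open import Data.Product using (_×_; _,_; proj₁; proj₂)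
open import Data.Sum using (_⊎_; inj₁; inj₂)
import Data.Sum as Sum
open import Function using (_∘_; id; Equivalence)
open import Function.Bundles using (_⤖_; Bijection; mk↔ₛ′)
open import Function.Properties.Inverse using (↔⇒⤖)
open import Relation.Binary.PropositionalEquality
open import Relation.Nullary using (yes; no; contradiction)
open ≡-Reasoning

∑ : ℕ → (ℕ → ℕ) → ℕ
∑ zero    g = 0
∑ (suc m) g = g 0 + ∑ m (g ∘ suc)

syntax ∑ m (λ i → e) = ∑[ i < m ] e

∑-cong : ∀ m {g h : ℕ → ℕ} → (∀ i → i < m → g i ≡ h i) → ∑ m g ≡ ∑ m h
∑-cong zero    g≡h = refl
∑-cong (suc m) g≡h = cong₂ _+_ (g≡h 0 z<s) (∑-cong m (λ i i<m → g≡h (suc i) (s<s i<m)))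

∑-zero : ∀ m → ∑[ i < m ] 0 ≡ 0
∑-zero zero    = refl
∑-zero (suc m) = ∑-zero m

∑-const : ∀ m c → ∑[ i < m ] c ≡ m * c
∑-const zero    c = refl
∑-const (suc m) c = cong (c +_) (∑-const m c)

∑-split : ∀ a b (g : ℕ → ℕ) → ∑ (a + b) g ≡ ∑ a g + ∑[ i < b ] g (a + i)
∑-split zero    b g = refl
∑-split (suc a) b g = trans (cong (g 0 +_) (∑-split a b (g ∘ suc))) (sym (+-assoc (g 0) _ _))

∑-distrib-+ : ∀ m (g h : ℕ → ℕ) → ∑[ i < m ] (g i + h i) ≡ ∑ m g + ∑ m h
∑-distrib-+ zero    g h = refl
∑-distrib-+ (suc m) g h =
  trans (cong (g 0 + h 0 +_) (∑-distrib-+ m (g ∘ suc) (h ∘ suc))) (interchange (g 0) (h 0) _ _)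

∑-last : ∀ m (g : ℕ → ℕ) → ∑ (suc m) g ≡ ∑ m g + g m
∑-last zero    g = +-comm (g 0) 0
∑-last (suc m) g = trans (cong (g 0 +_) (∑-last m (g ∘ suc))) (sym (+-assoc (g 0) _ _))

∑-reverse : ∀ m (g : ℕ → ℕ) → ∑ m g ≡ ∑[ i < m ] g (m ∸ suc i)
∑-reverse zero    g = refl
∑-reverse (suc m) g =
  trans (∑-last m g) (trans (+-comm (∑ m g) (g m)) (cong (g m +_) (∑-reverse m g)))

∑-single : ∀ m {a} (g : ℕ → ℕ) → a < m → ∑[ i < m ] (if i ≡ᵇ a then g i else 0) ≡ g a
∑-single (suc m) {zero}  g _   = trans (cong (g 0 +_) (∑-zero m)) (+-identityʳ (g 0))
∑-single (suc m) {suc a} g a<m = ∑-single m (g ∘ suc) (s<s⁻¹ a<m)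

∑-pairedHalves : ∀ m (g : ℕ → ℕ) {c} → (∀ i → i < m → g i + g (m + i) ≡ c) → ∑ (m + m) g ≡ m * c
∑-pairedHalves m g {c} paired = begin
  ∑ (m + m) g                   ≡⟨ ∑-split m m g ⟩
  ∑ m g + ∑[ i < m ] g (m + i)  ≡⟨ ∑-distrib-+ m g (λ i → g (m + i)) ⟨
  ∑[ i < m ] (g i + g (m + i))  ≡⟨ ∑-cong m paired ⟩
  ∑[ i < m ] c                  ≡⟨ ∑-const m c ⟩
  m * c                         ∎

∑-pairedReverse : ∀ m (g : ℕ → ℕ) {c} → (∀ i j → suc (i + j) ≡ m + m → g i + g j ≡ c) →
                  ∑ (m + m) g ≡ m * c
∑-pairedReverse m g {c} paired = begin
  ∑ (m + m) g                                 ≡⟨ ∑-split m m g ⟩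
  ∑ m g + ∑[ i < m ] g (m + i)                ≡⟨ cong (∑ m g +_) (∑-reverse m (λ i → g (m + i))) ⟩
  ∑ m g + ∑[ i < m ] g (m + (m ∸ suc i))      ≡⟨ ∑-distrib-+ m g (λ i → g (m + (m ∸ suc i))) ⟨
  ∑[ i < m ] (g i + g (m + (m ∸ suc i)))      ≡⟨ ∑-cong m (λ i i<m → paired i _ (mirror i<m)) ⟩
  ∑[ i < m ] c                                ≡⟨ ∑-const m c ⟩
  m * c                                       ∎
  where
  mirror : ∀ {i} → i < m → suc (i + (m + (m ∸ suc i))) ≡ m + m
  mirror {i} i<m = trans (x∙yz≈y∙xz (suc i) m (m ∸ suc i)) (cong (m +_) (m+[n∸m]≡n i<m))

if-split : ∀ s (v : ℕ) → (if s then v else 0) + (if not s then v else 0) ≡ v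
if-split true  v = +-identityʳ v
if-split false v = refl

if-∨ : ∀ x y (v : ℕ) → (T x → T y → ⊥) →
       (if x ∨ y then v else 0) ≡ (if x then v else 0) + (if y then v else 0)
if-∨ true  true  v disjoint = ⊥-elim (disjoint _ _)
if-∨ true  false v _        = sym (+-identityʳ v)
if-∨ false y     v _        = refl

TwoImplyThird : Bool → Bool → Bool → Set
TwoImplyThird a b c = (T a → T b → T c) × (T a → T c → T b) × (T b → T c → T a)

daggerAdj : (oi oj h si sj : Bool) → Bool
daggerAdj oi oj h si sj = (oi ∧ oj ∧ h ∧ not (si ∧ sj)) ∨ (not oi ∧ sj) ∨ (si ∧ not oj)

-- Below, c says "i, j are equal or antipodal" and a, b say the same of i, j and v_k;
-- the triangle condition is the transitivity of that relation.
daggerAdj-xor : ∀ {oi oj h si sj} a b c → h ≡ not c → si ≡ oi ∧ not a → sj ≡ oj ∧ not b →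
                (T oi → TwoImplyThird a b c) → daggerAdj oi oj h si sj ≡ si xor sj
daggerAdj-xor {oi} {oj} a b c refl refl refl = byCases oi oj a b c
  where
  byCases : ∀ oi oj a b c → (T oi → TwoImplyThird a b c) →
            daggerAdj oi oj (not c) (oi ∧ not a) (oj ∧ not b) ≡ (oi ∧ not a) xor (oj ∧ not b)
  byCases false oj    a     b     c     _ = ∨-identityʳ _
  byCases true  false false b     c     _ = refl
  byCases true  false true  b     c     _ = refl
  byCases true  true  true  true  true  _ = refl
  byCases true  true  true  true  false t = ⊥-elim (proj₁ (t _) _ _)
  byCases true  true  true  false false _ = refl
  byCases true  true  true  false true  t = ⊥-elim (proj₁ (proj₂ (t _)) _ _)
  byCases true  true  false true  false _ = refl
  byCases true  true  false true  true  t = ⊥-elim (proj₂ (proj₂ (t _)) _ _)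
  byCases true  true  false false false _ = refl
  byCases true  true  false false true  _ = refl

sumOver : ∀ {N} → (Fin N → Bool) → (Fin N → ℕ) → ℕ
sumOver {N} P f = sum (map (λ v → if P v then f v else 0) (allFin N))

sum-tabulate : ∀ N (g : Fin N → ℕ) (h : ℕ → ℕ) → (∀ v → g v ≡ h (toℕ v)) →
               sum (tabulate g) ≡ ∑ N h
sum-tabulate zero    g h _   = refl
sum-tabulate (suc N) g h g≡h =
  cong₂ _+_ (g≡h Fin.zero) (sum-tabulate N (g ∘ Fin.suc) (h ∘ suc) (g≡h ∘ Fin.suc))

sumOver-∑ : ∀ {N} (p : ℕ → Bool) (f : Fin N → ℕ) (g : ℕ → ℕ) → (∀ v → f v ≡ g (toℕ v)) →
            sumOver (p ∘ toℕ) f ≡ ∑[ i < N ] (if p i then g i else 0)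
sumOver-∑ {N} p f g f≡g = trans (cong sum (map-tabulate id summand))
  (sum-tabulate N summand _ (λ v → cong (λ x → if p (toℕ v) then x else 0) (f≡g v)))
  where
  summand : Fin N → ℕ
  summand v = if p (toℕ v) then f v else 0

labelling : ∀ {N} → Fin N ⤖ Fin N → Fin N → ℕ
labelling σ v = suc (toℕ (Bijection.to σ v))

completeBipartite-isDistanceMagic :
  ∀ {N} (G : Graph N) (side : Fin N → Bool) (σ : Fin N ⤖ Fin N) →
  (∀ u v → G u v ≡ side u xor side v) →
  sumOver side (labelling σ) ≡ sumOver (not ∘ side) (labelling σ) →
  IsDistanceMagic G
completeBipartite-isDistanceMagic {N} G side σ G≡xor balanced =
  labelling σ , (σ , λ _ → refl) , sumOver side (labelling σ) , weight≡
  where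
  oppositeSum : ∀ s → sumOver (λ v → s xor side v) (labelling σ) ≡ sumOver side (labelling σ)
  oppositeSum false = refl
  oppositeSum true  = sym balanced

  weight≡ : ∀ u → weight G (labelling σ) u ≡ sumOver side (labelling σ)
  weight≡ u = trans
    (cong sum (map-cong (λ v → cong (λ e → if e then labelling σ v else 0) (G≡xor u v)) (allFin N)))
    (oppositeSum (side u))

module _ {N : ℕ} (h : ℕ → ℕ) (h-< : ∀ {i} → i < N → h i < N)
         (h-involutive : ∀ {i} → i < N → h (h i) ≡ i) where

  restrict : Fin N → Fin N
  restrict v = fromℕ< (h-< (toℕ<n v))

  toℕ-restrict : ∀ v → toℕ (restrict v) ≡ h (toℕ v)
  toℕ-restrict v = toℕ-fromℕ< _

  restrict-involutive : ∀ v → restrict (restrict v) ≡ v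
  restrict-involutive v = toℕ-injective (begin
    toℕ (restrict (restrict v))  ≡⟨ toℕ-restrict (restrict v) ⟩
    h (toℕ (restrict v))         ≡⟨ cong h (toℕ-restrict v) ⟩
    h (h (toℕ v))                ≡⟨ h-involutive (toℕ<n v) ⟩
    toℕ v                        ∎)

  involution⤖ : Fin N ⤖ Fin N
  involution⤖ = ↔⇒⤖ (mk↔ₛ′ restrict restrict restrict-involutive restrict-involutive)

≡ᵇ-comm : ∀ m n → (m ≡ᵇ n) ≡ (n ≡ᵇ m)
≡ᵇ-comm zero    zero    = refl
≡ᵇ-comm zero    (suc n) = refl
≡ᵇ-comm (suc m) zero    = refl
≡ᵇ-comm (suc m) (suc n) = ≡ᵇ-comm m n

module Diameters (n : ℕ) where

  M : ℕ
  M = suc (suc (2 * n))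

  antipode : ℕ → ℕ
  antipode x = (x + n + 1) % M

  M≡ : M ≡ suc n + suc n
  M≡ = lemma n
    where
    lemma : ∀ n → suc (suc (2 * n)) ≡ suc n + suc n
    lemma = solve-∀

  data Half : ℕ → Set where
    lower : ∀ {x} → x ≤ n → Half x
    upper : ∀ {y} → y ≤ n → Half (suc n + y)

  half : ∀ {x} → x < M → Half x
  half {x} x<M with ≤-<-connex x n
  ... | inj₁ x≤n = lower x≤n
  ... | inj₂ n<x = subst Half (m+[n∸m]≡n n<x) (upper (s≤s⁻¹ x∸1+n<1+n))
    where
    x∸1+n<1+n : x ∸ suc n < suc n
    x∸1+n<1+n = m<n+o⇒m∸n<o x (suc n) (subst (x <_) M≡ x<M)

  upper<M : ∀ {y} → y ≤ n → suc n + y < M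
  upper<M {y} y≤n = subst (suc n + y <_) (sym M≡) (+-monoʳ-< (suc n) (s≤s y≤n))

  lower<M : ∀ {x} → x ≤ n → x < M
  lower<M {x} x≤n = ≤-<-trans (m≤n+m x (suc n)) (upper<M x≤n)

  antipode-lower : ∀ {x} → x ≤ n → antipode x ≡ suc n + x
  antipode-lower {x} x≤n = trans (cong (_% M) (lemma x n)) (m<n⇒m%n≡m (upper<M x≤n))
    where
    lemma : ∀ x n → x + n + 1 ≡ suc n + x
    lemma = solve-∀

  antipode-upper : ∀ {y} → y ≤ n → antipode (suc n + y) ≡ y
  antipode-upper {y} y≤n = begin
    (suc n + y + n + 1) % M  ≡⟨ cong (_% M) (lemma y n) ⟩
    (y + M) % M              ≡⟨ [m+n]%n≡m%n y M ⟩
    y % M                    ≡⟨ m<n⇒m%n≡m (lower<M y≤n) ⟩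
    y                        ∎
    where
    lemma : ∀ y n → suc n + y + n + 1 ≡ y + suc (suc (2 * n))
    lemma = solve-∀

  antipode-< : ∀ x → antipode x < M
  antipode-< x = m%n<n (x + n + 1) M

  antipode-involutive : ∀ {x} → x < M → antipode (antipode x) ≡ x
  antipode-involutive x<M with half x<M
  ... | lower x≤n = trans (cong antipode (antipode-lower x≤n)) (antipode-upper x≤n)
  ... | upper y≤n = trans (cong antipode (antipode-upper y≤n)) (antipode-lower y≤n)

  antipode-irreflexive : ∀ {x} → x < M → antipode x ≢ x
  antipode-irreflexive {x} x<M eq with half x<M
  ... | lower x≤n = m≢1+n+m x (sym (trans (sym (antipode-lower x≤n)) eq))
  ... | upper {y} y≤n = m≢1+n+m y (trans (sym (antipode-upper y≤n)) eq)

  SameDiameter : ℕ → ℕ → Set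
  SameDiameter x y = y ≡ x ⊎ y ≡ antipode x

  sameDiameterᵇ : ℕ → ℕ → Bool
  sameDiameterᵇ x y = (y ≡ᵇ x) ∨ (y ≡ᵇ antipode x)

  sameDiameterᵇ⇒SameDiameter : ∀ x y → T (sameDiameterᵇ x y) → SameDiameter x y
  sameDiameterᵇ⇒SameDiameter x y =
    Sum.map (≡ᵇ⇒≡ y x) (≡ᵇ⇒≡ y (antipode x)) ∘ Equivalence.to T-∨

  SameDiameter⇒sameDiameterᵇ : ∀ {x y} → SameDiameter x y → T (sameDiameterᵇ x y)
  SameDiameter⇒sameDiameterᵇ {x} {y} =
    Equivalence.from T-∨ ∘ Sum.map (≡⇒≡ᵇ y x) (≡⇒≡ᵇ y (antipode x))

  SameDiameter-sym : ∀ {x y} → x < M → SameDiameter x y → SameDiameter y x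
  SameDiameter-sym x<M (inj₁ refl) = inj₁ refl
  SameDiameter-sym x<M (inj₂ refl) = inj₂ (sym (antipode-involutive x<M))

  SameDiameter-trans : ∀ {x y z} → x < M → SameDiameter x y → SameDiameter y z → SameDiameter x z
  SameDiameter-trans x<M (inj₁ refl) y~z         = y~z
  SameDiameter-trans x<M (inj₂ refl) (inj₁ refl) = inj₂ refl
  SameDiameter-trans x<M (inj₂ refl) (inj₂ refl) = inj₁ (antipode-involutive x<M)

  sameDiameterᵇ-triangle : ∀ k i j → k < M → i < M →
    TwoImplyThird (sameDiameterᵇ k i) (sameDiameterᵇ k j) (sameDiameterᵇ i j)
  sameDiameterᵇ-triangle k i j k<M i<M =
      (λ k~i k~j → ⇒ᵇ (SameDiameter-trans i<M (SameDiameter-sym k<M (ᵇ⇒ k i k~i)) (ᵇ⇒ k j k~j)))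
    , (λ k~i i~j → ⇒ᵇ (SameDiameter-trans k<M (ᵇ⇒ k i k~i) (ᵇ⇒ i j i~j)))
    , (λ k~j i~j → ⇒ᵇ (SameDiameter-trans k<M (ᵇ⇒ k j k~j) (SameDiameter-sym i<M (ᵇ⇒ i j i~j))))
    where
    ᵇ⇒ : ∀ x y → T (sameDiameterᵇ x y) → SameDiameter x y
    ᵇ⇒ = sameDiameterᵇ⇒SameDiameter
    ⇒ᵇ : ∀ {x y} → SameDiameter x y → T (sameDiameterᵇ x y)
    ⇒ᵇ = SameDiameter⇒sameDiameterᵇ

  Hadj≡not-sameDiameterᵇ : ∀ i j → Hadj n i j ≡ not (sameDiameterᵇ i j)
  Hadj≡not-sameDiameterᵇ i j =
    trans (cong (λ e → not e ∧ not (j ≡ᵇ antipode i)) (≡ᵇ-comm i j)) (sym (deMorgan₂ (j ≡ᵇ i) (j ≡ᵇ antipode i)))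

module _ (n k : ℕ) where
  open HDagger n k
  open Diameters n

  inS≡ : ∀ i → inS i ≡ orig i ∧ not (sameDiameterᵇ k i)
  inS≡ i = cong (orig i ∧_) (sym (deMorgan₂ (i ≡ᵇ k) (i ≡ᵇ antipode k)))

  adjℕ≡xor : k < M → ∀ i j → adjℕ i j ≡ inS i xor inS j
  adjℕ≡xor k<M i j =
    daggerAdj-xor (sameDiameterᵇ k i) (sameDiameterᵇ k j) (sameDiameterᵇ i j)
      (Hadj≡not-sameDiameterᵇ i j) (inS≡ i) (inS≡ j)
      (λ orig-i → sameDiameterᵇ-triangle k i j k<M (<ᵇ⇒< i M orig-i))

module Labelling (p : ℕ) where

  n : ℕ
  n = suc p

  open Diameters n using (M; M≡; lower; upper; half; lower<M; upper<M; antipode; antipode-lower; antipode-upper)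

  L : ℕ
  L = p + p

  M+L≡4n : M + L ≡ 4 * n
  M+L≡4n = lemma p
    where
    lemma : ∀ p → suc (suc (2 * suc p)) + (p + p) ≡ 4 * suc p
    lemma = solve-∀

  M≤4n : M ≤ 4 * n
  M≤4n = subst (M ≤_) M+L≡4n (m≤m+n M L)

  σ : ℕ → ℕ
  σ i with i ≤? n
  ... | yes _ = i
  ... | no  _ = 5 * n ∸ i

  σ-lower : ∀ {i} → i ≤ n → σ i ≡ i
  σ-lower {i} i≤n with i ≤? n
  ... | yes _   = refl
  ... | no  i≰n = contradiction i≤n i≰n

  σ-upper : ∀ {i} → n < i → i < 4 * n → σ i + i ≡ 5 * n
  σ-upper {i} n<i i<4n with i ≤? n
  ... | yes i≤n = contradiction i≤n (<⇒≱ n<i)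
  ... | no  _   = m∸n+n≡m (≤-trans (<⇒≤ i<4n) (*-monoˡ-≤ n (n≤1+n 4)))

  σ-upper-bounds : ∀ {i} → n < i → i < 4 * n → n < σ i × σ i < 4 * n
  σ-upper-bounds {i} n<i i<4n =
      +-cancelʳ-< i n (σ i) (subst (n + i <_) n+4n≡σi+i (+-monoʳ-< n i<4n))
    , +-cancelʳ-< i (σ i) (4 * n) (subst (_< 4 * n + i) (sym σi+i≡4n+n) (+-monoʳ-< (4 * n) n<i))
    where
    lemma : ∀ n → 5 * n ≡ 4 * n + n
    lemma = solve-∀
    σi+i≡4n+n : σ i + i ≡ 4 * n + n
    σi+i≡4n+n = trans (σ-upper n<i i<4n) (lemma n)
    n+4n≡σi+i : n + 4 * n ≡ σ i + i
    n+4n≡σi+i = trans (+-comm n (4 * n)) (sym σi+i≡4n+n)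

  σ-< : ∀ {i} → i < 4 * n → σ i < 4 * n
  σ-< {i} i<4n with ≤-<-connex i n
  ... | inj₁ i≤n = subst (_< 4 * n) (sym (σ-lower i≤n)) i<4n
  ... | inj₂ n<i = proj₂ (σ-upper-bounds n<i i<4n)

  σ-involutive : ∀ {i} → i < 4 * n → σ (σ i) ≡ i
  σ-involutive {i} i<4n with ≤-<-connex i n
  ... | inj₁ i≤n = trans (cong σ (σ-lower i≤n)) (σ-lower i≤n)
  ... | inj₂ n<i = +-cancelʳ-≡ (σ i) _ _ (begin
    σ (σ i) + σ i  ≡⟨ σ-upper n<σi σi<4n ⟩
    5 * n          ≡⟨ σ-upper n<i i<4n ⟨
    σ i + i        ≡⟨ +-comm (σ i) i ⟩
    i + σ i        ∎)
    where
    n<σi : n < σ i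
    n<σi = proj₁ (σ-upper-bounds n<i i<4n)
    σi<4n : σ i < 4 * n
    σi<4n = proj₂ (σ-upper-bounds n<i i<4n)

  lab : ℕ → ℕ
  lab i = suc (σ i)

  lab-antipodal : ∀ {i} → i ≤ n → lab i + lab (suc n + i) ≡ suc (4 * n)
  lab-antipodal {i} i≤n = +-cancelʳ-≡ j _ _ (begin
    (lab i + lab j) + j        ≡⟨ cong (λ x → (suc x + lab j) + j) (σ-lower i≤n) ⟩
    (suc i + lab j) + j        ≡⟨ +-assoc (suc i) (lab j) j ⟩
    suc i + suc (σ j + j)      ≡⟨ cong (λ x → suc i + suc x) σj+j≡5n ⟩
    suc i + suc (5 * n)        ≡⟨ lemma i n ⟩
    suc (4 * n) + j            ∎)
    where
    j : ℕ
    j = suc n + i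
    σj+j≡5n : σ j + j ≡ 5 * n
    σj+j≡5n = σ-upper (s≤s (m≤m+n n i)) (<-≤-trans (upper<M i≤n) M≤4n)
    lemma : ∀ i n → suc i + suc (5 * n) ≡ suc (4 * n) + (suc n + i)
    lemma = solve-∀

  lab-mirrored : ∀ {j j′} → suc (j + j′) ≡ L → lab (M + j) + lab (M + j′) ≡ suc (4 * n)
  lab-mirrored {j} {j′} mirrored = +-cancelʳ-≡ (x + y) _ _ (begin
    (lab x + lab y) + (x + y)           ≡⟨ interchange (lab x) (lab y) x y ⟩
    (lab x + x) + (lab y + y)           ≡⟨ cong₂ (λ a b → suc a + suc b) (σ-upper (new> j) (new< j<L))
                                                                        (σ-upper (new> j′) (new< j′<L)) ⟩
    suc (5 * n) + suc (5 * n)           ≡⟨ lemma₁ p ⟩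
    (4 * n + (M + M)) + L               ≡⟨ cong (4 * n + (M + M) +_) mirrored ⟨
    (4 * n + (M + M)) + suc (j + j′)    ≡⟨ lemma₂ (4 * n) M j j′ ⟩
    suc (4 * n) + (x + y)               ∎)
    where
    x y : ℕ
    x = M + j
    y = M + j′
    j<L : j < L
    j<L = subst (j <_) mirrored (s≤s (m≤m+n j j′))
    j′<L : j′ < L
    j′<L = subst (j′ <_) mirrored (s≤s (m≤n+m j′ j))
    new> : ∀ i → n < M + i
    new> i = <-≤-trans (lower<M ≤-refl) (m≤m+n M i)
    new< : ∀ {i} → i < L → M + i < 4 * n
    new< {i} i<L = subst (M + i <_) M+L≡4n (+-monoʳ-< M i<L)
    lemma₁ : ∀ p → suc (5 * suc p) + suc (5 * suc p)
                   ≡ (4 * suc p + (suc (suc (2 * suc p)) + suc (suc (2 * suc p)))) + (p + p)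
    lemma₁ = solve-∀
    lemma₂ : ∀ a m j j′ → (a + (m + m)) + suc (j + j′) ≡ suc a + ((m + j) + (m + j′))
    lemma₂ = solve-∀

  lab-antipode : ∀ {x} → x < M → lab x + lab (antipode x) ≡ suc (4 * n)
  lab-antipode {x} x<M with half x<M
  ... | lower x≤n = trans (cong (λ y → lab x + lab y) (antipode-lower x≤n)) (lab-antipodal x≤n)
  ... | upper {y} y≤n = trans (cong (λ z → lab (suc n + y) + lab z) (antipode-upper y≤n))
                              (trans (+-comm (lab (suc n + y)) (lab y)) (lab-antipodal y≤n))

  ∑-lab-original : ∑ M lab ≡ suc n * suc (4 * n)
  ∑-lab-original = trans (cong (λ m → ∑ m lab) M≡)
    (∑-pairedHalves (suc n) lab (λ i i<1+n → lab-antipodal (s≤s⁻¹ i<1+n)))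

  ∑-lab-new : ∑[ j < L ] lab (M + j) ≡ p * suc (4 * n)
  ∑-lab-new = ∑-pairedReverse p (λ j → lab (M + j)) (λ _ _ → lab-mirrored)

module Sides (p k : ℕ) (k<M : k < suc (suc (2 * suc p))) where
  open Labelling p
  open Diameters n
  open HDagger n k

  onS offS : ℕ → ℕ
  onS  i = if inS i then lab i else 0
  offS i = if not (inS i) then lab i else 0

  orig-original : ∀ {i} → i < M → orig i ≡ true
  orig-original i<M = Equivalence.to T-≡ (<⇒<ᵇ i<M)

  inS-new : ∀ j → inS (M + j) ≡ false
  inS-new j = trans (inS≡ n k (M + j)) (cong (_∧ not (sameDiameterᵇ k (M + j))) orig-new)
    where
    orig-new : orig (M + j) ≡ false
    orig-new = ¬-not (λ orig≡true → m+n≮m M j (<ᵇ⇒< (M + j) M (Equivalence.from T-≡ orig≡true)))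

  offS-original : ∀ {i} → i < M →
    offS i ≡ (if i ≡ᵇ k then lab i else 0) + (if i ≡ᵇ antipode k then lab i else 0)
  offS-original {i} i<M =
    trans (cong (λ s → if s then lab i else 0) notInS≡) (if-∨ (i ≡ᵇ k) (i ≡ᵇ antipode k) (lab i) disjoint)
    where
    notInS≡ : not (inS i) ≡ sameDiameterᵇ k i
    notInS≡ = begin
      not (inS i)                              ≡⟨ cong not (inS≡ n k i) ⟩
      not (orig i ∧ not (sameDiameterᵇ k i))   ≡⟨ cong (λ o → not (o ∧ not (sameDiameterᵇ k i))) (orig-original i<M) ⟩
      not (not (sameDiameterᵇ k i))            ≡⟨ not-involutive _ ⟩
      sameDiameterᵇ k i                        ∎
    disjoint : T (i ≡ᵇ k) → T (i ≡ᵇ antipode k) → ⊥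
    disjoint i≡k i≡k̄ = antipode-irreflexive k<M (trans (sym (≡ᵇ⇒≡ i _ i≡k̄)) (≡ᵇ⇒≡ i k i≡k))

  ∑-offS-original : ∑ M offS ≡ suc (4 * n)
  ∑-offS-original = begin
    ∑ M offS
      ≡⟨ ∑-cong M (λ i i<M → offS-original i<M) ⟩
    ∑[ i < M ] ((if i ≡ᵇ k then lab i else 0) + (if i ≡ᵇ antipode k then lab i else 0))
      ≡⟨ ∑-distrib-+ M (λ i → if i ≡ᵇ k then lab i else 0) (λ i → if i ≡ᵇ antipode k then lab i else 0) ⟩
    ∑[ i < M ] (if i ≡ᵇ k then lab i else 0) + ∑[ i < M ] (if i ≡ᵇ antipode k then lab i else 0)
      ≡⟨ cong₂ _+_ (∑-single M lab k<M) (∑-single M lab (antipode-< k)) ⟩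
    lab k + lab (antipode k)
      ≡⟨ lab-antipode k<M ⟩
    suc (4 * n)
      ∎

  ∑-onS-original : ∑ M onS ≡ n * suc (4 * n)
  ∑-onS-original = +-cancelʳ-≡ (suc (4 * n)) _ _ (begin
    ∑ M onS + suc (4 * n)          ≡⟨ cong (∑ M onS +_) ∑-offS-original ⟨
    ∑ M onS + ∑ M offS             ≡⟨ ∑-distrib-+ M onS offS ⟨
    ∑[ i < M ] (onS i + offS i)    ≡⟨ ∑-cong M (λ i _ → if-split (inS i) (lab i)) ⟩
    ∑ M lab                        ≡⟨ ∑-lab-original ⟩
    suc n * suc (4 * n)            ≡⟨ +-comm (suc (4 * n)) (n * suc (4 * n)) ⟩
    n * suc (4 * n) + suc (4 * n)  ∎)

  ∑-onS : ∑ (4 * n) onS ≡ n * suc (4 * n)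
  ∑-onS = begin
    ∑ (4 * n) onS                     ≡⟨ cong (λ m → ∑ m onS) M+L≡4n ⟨
    ∑ (M + L) onS                     ≡⟨ ∑-split M L onS ⟩
    ∑ M onS + ∑[ j < L ] onS (M + j)  ≡⟨ cong₂ _+_ ∑-onS-original (trans (∑-cong L onS-new) (∑-zero L)) ⟩
    n * suc (4 * n) + 0               ≡⟨ +-identityʳ _ ⟩
    n * suc (4 * n)                   ∎
    where
    onS-new : ∀ j → j < L → onS (M + j) ≡ 0
    onS-new j _ = cong (λ s → if s then lab (M + j) else 0) (inS-new j)

  ∑-offS : ∑ (4 * n) offS ≡ n * suc (4 * n)
  ∑-offS = begin
    ∑ (4 * n) offS                      ≡⟨ cong (λ m → ∑ m offS) M+L≡4n ⟨
    ∑ (M + L) offS                      ≡⟨ ∑-split M L offS ⟩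
    ∑ M offS + ∑[ j < L ] offS (M + j)  ≡⟨ cong₂ _+_ ∑-offS-original (trans (∑-cong L offS-new) ∑-lab-new) ⟩
    suc (4 * n) + p * suc (4 * n)       ≡⟨⟩
    n * suc (4 * n)                     ∎
    where
    offS-new : ∀ j → j < L → offS (M + j) ≡ lab (M + j)
    offS-new j _ = cong (λ s → if not s then lab (M + j) else 0) (inS-new j)

  side : Fin (4 * n) → Bool
  side u = inS (toℕ u)

  σ⤖ : Fin (4 * n) ⤖ Fin (4 * n)
  σ⤖ = involution⤖ σ σ-< σ-involutive

  balanced : sumOver side (labelling σ⤖) ≡ sumOver (not ∘ side) (labelling σ⤖)
  balanced = begin
    sumOver side (labelling σ⤖)          ≡⟨ sumOver-∑ inS _ lab labelling≡lab ⟩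
    ∑ (4 * n) onS                        ≡⟨ trans ∑-onS (sym ∑-offS) ⟩
    ∑ (4 * n) offS                       ≡⟨ sumOver-∑ (not ∘ inS) _ lab labelling≡lab ⟨
    sumOver (not ∘ side) (labelling σ⤖)  ∎
    where
    labelling≡lab : ∀ v → labelling σ⤖ v ≡ lab (toℕ v)
    labelling≡lab v = cong suc (toℕ-restrict σ σ-< σ-involutive v)

-- The hypothesis 1 < n only rules out n = 0: the construction works for every n ≥ 1.
mainTheorem3 : (n : ℕ) → 1 < n → (k : ℕ) → k < suc (suc (2 * n)) →
    IsDistanceMagic (HDaggerGraph n k)
mainTheorem3 zero    ()  k k<M
mainTheorem3 (suc p) _   k k<M =
  completeBipartite-isDistanceMagic (HDaggerGraph (suc p) k) side σ⤖
    (λ u v → adjℕ≡xor (suc p) k k<M (toℕ u) (toℕ v)) balanced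
  where open Sides p k k<M
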